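{- Let $\mathcal{G}=(V,E)$ be a temporal graph, $s,z\in V$, $\delta\in\mathbb{N}$, $D\subseteq E$, and let $\mathcal{G}^*=(V,E\cup E^*)$ with $E^*=\{(v,w,t,\lambda+\delta)\mid (v,w,t,\lambda)\in E\}$. There is a $D$-delayed temporal walk from $s$ to $z$ in $\mathcal{G}$ if and only if there is a temporal walk from $s$ to $z$ in $\mathcal{G}^*_D:=(V,(E\setminus D)\cup E^*)$.
   Context: A temporal graph $\mathcal{G}=(V,E)$ consists of a finite vertex set $V$ and a finite set $E$ of time arcs $(v,w,t,\lambda)$ (start vertex $v$, end vertex $w$, time label $t\in\mathbb{N}$, traversal time $\lambda\in\mathbb{N}$). A temporal walk from $s$ to $z$ is a sequence of time arcs $(v_i,w_i,t_i,\lambda_i)_{i=1}^{k}$ with $v_1=s$, $w_k=z$, $v_{i+1}=w_i$ and $t_{i+1}\ge t_i+\lambda_i$ for all $i<k$. For a delay $\delta\in\mathbb{N}$ and $D\subseteq E$, a $D$-delayed temporal walk is a sequence $(e_i)=(v_i,w_i,t_i,\lambda_i)_{i=1}^k$ of arcs of $E$ with $v_{i+1}=w_i$ and $t_i+\lambda_i+[e_i\in D]\cdot\delta\le t_{i+1}$ for all $i<k$, where $[P]$ is $1$ if $P$ holds and $0$ otherwise. -}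

module Defs where

open import Data.Nat using (ℕ; _+_; _*_; _≤_)
open import Data.Fin using (Fin)
import Data.Fin.Properties as FinP
import Data.Nat.Properties as NatP
open import Data.List using (List; []; _∷_; [_])
open import Data.List.Membership.Propositional using (_∈_)
open import Data.List.Membership.DecPropositional using () renaming (_∈?_ to ∈?-gen)
open import Data.List.Relation.Binary.Subset.Propositional using (_⊆_)
open import Data.Product using (Σ; ∃; _×_; _,_)
open import Data.Sum using (_⊎_)
open import Relation.Nullary using (Dec; yes; no; ¬_)
open import Relation.Binary.PropositionalEquality using (_≡_; refl; cong)
open import Relation.Binary.Definitions using (DecidableEquality)

record Arc (n : ℕ) : Set where
  constructor arc
  field
    src  : Fin n
    tgt  : Fin n
    time : ℕ
    trav : ℕ
open Arc public

_≟Arc_ : ∀ {n} → DecidableEquality (Arc n)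
arc v w t l ≟Arc arc v' w' t' l' with FinP._≟_ v v' | FinP._≟_ w w' | NatP._≟_ t t' | NatP._≟_ l l'
... | yes refl | yes refl | yes refl | yes refl = yes refl
... | no p | _ | _ | _ = no λ { refl → p refl }
... | yes _ | no p | _ | _ = no λ { refl → p refl }
... | yes _ | yes _ | no p | _ = no λ { refl → p refl }
... | yes _ | yes _ | yes _ | no p = no λ { refl → p refl }

iverson : ∀ {P : Set} → Dec P → ℕ
iverson (yes _) = 1
iverson (no _) = 0

inD : ∀ {n} → Arc n → List (Arc n) → ℕ
inD e D = iverson (∈?-gen _≟Arc_ e D)

ArcSet : ℕ → Set₁
ArcSet n = Arc n → Set

data TemporalWalk {n : ℕ} (A : ArcSet n) : Fin n → Fin n → List (Arc n) → Set where
  single : ∀ {e} → A e → TemporalWalk A (src e) (tgt e) [ e ]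
  step   : ∀ {e e' es z} → A e → TemporalWalk A (tgt e) z (e' ∷ es) →
           time e + trav e ≤ time e' →
           TemporalWalk A (src e) z (e ∷ e' ∷ es)

data DelayedWalk {n : ℕ} (E D : List (Arc n)) (δ : ℕ) : Fin n → Fin n → List (Arc n) → Set where
  single : ∀ {e} → e ∈ E → DelayedWalk E D δ (src e) (tgt e) [ e ]
  step   : ∀ {e e' es z} → e ∈ E → DelayedWalk E D δ (tgt e) z (e' ∷ es) →
           time e + trav e + inD e D * δ ≤ time e' →
           DelayedWalk E D δ (src e) z (e ∷ e' ∷ es)

delayArc : ∀ {n} → ℕ → Arc n → Arc n
delayArc δ (arc v w t l) = arc v w t (l + δ)

InEStar : ∀ {n} → List (Arc n) → ℕ → ArcSet n
InEStar E δ e = Σ _ λ e₀ → e₀ ∈ E × e ≡ delayArc δ e₀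

GStarD : ∀ {n} → List (Arc n) → List (Arc n) → ℕ → ArcSet n
GStarD E D δ e = ((e ∈ E) × ¬ (e ∈ D)) ⊎ InEStar E δ e

{-# OPTIONS --safe #-}
-- Absorbing the delay into the traversal time turns each arc e of E into the arc
-- (v, w, t, λ + [e ∈ D]·δ), which lies in (E ∖ D) ∪ E* and has the same arrival time as
-- e has under the delay; so a D-delayed walk becomes a temporal walk in G*_D arc by arc.
-- Conversely every arc of G*_D comes from an arc of E with the same endpoints and
-- departure time whose delayed arrival is no later, so a temporal walk in G*_D becomes a
-- D-delayed walk by replacing each arc by its origin.
module Submission where

open import Defs
open import Data.Nat using (ℕ; _+_; _*_; _≤_; z≤n)
open import Data.Nat.Properties using (≤-reflexive; ≤-trans; +-assoc; +-identityʳ; +-monoʳ-≤)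
open import Data.Fin using (Fin)
open import Data.List using (List; []; _∷_; map)
open import Data.List.Membership.Propositional using (_∈_)
open import Data.List.Membership.DecPropositional using () renaming (_∈?_ to ∈?-gen)
open import Data.List.Relation.Binary.Subset.Propositional using (_⊆_)
open import Data.Product using (∃; ∃₂; _,_)
open import Data.Sum using (inj₁; inj₂)
open import Data.Empty using (⊥-elim)
open import Function.Bundles using (_⇔_; mk⇔)
open import Relation.Nullary using (Dec; yes; no; ¬_)
open import Relation.Binary.PropositionalEquality using (_≡_; refl; cong; subst; sym; trans)

iverson-no : ∀ {P : Set} (d : Dec P) → ¬ P → iverson d ≡ 0
iverson-no (yes p) ¬p = ⊥-elim (¬p p)
iverson-no (no _) _ = refl

iverson-*-≤ : ∀ {P : Set} (d : Dec P) (m : ℕ) → iverson d * m ≤ m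
iverson-*-≤ (yes _) m = ≤-reflexive (+-identityʳ m)
iverson-*-≤ (no _) m = z≤n

arrival : ∀ {n} → Arc n → ℕ
arrival e = time e + trav e

withTravel : ∀ {n} → Arc n → ℕ → Arc n
withTravel e l = arc (src e) (tgt e) (time e) l

module _ {n : ℕ} (E D : List (Arc n)) (δ : ℕ) where

  delayedArrival : Arc n → ℕ
  delayedArrival e = arrival e + inD e D * δ

  absorbDelay : Arc n → Arc n
  absorbDelay e = withTravel e (trav e + inD e D * δ)

  arrival-absorbDelay : ∀ e → arrival (absorbDelay e) ≡ delayedArrival e
  arrival-absorbDelay e = sym (+-assoc (time e) (trav e) (inD e D * δ))

  absorbDelay-∈ : ∀ {e} → e ∈ E → GStarD E D δ (absorbDelay e)
  absorbDelay-∈ {e} e∈E with ∈?-gen _≟Arc_ e D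
  ... | yes _   = inj₂ (e , e∈E , cong (λ k → withTravel e (trav e + k)) (+-identityʳ δ))
  ... | no e∉D  =
    subst (GStarD E D δ) (sym (cong (withTravel e) (+-identityʳ (trav e)))) (inj₁ (e∈E , e∉D))

  delayed⇒temporal : ∀ {s z ws} → DelayedWalk E D δ s z ws →
                     TemporalWalk (GStarD E D δ) s z (map absorbDelay ws)
  delayed⇒temporal (single e∈E) = single (absorbDelay-∈ e∈E)
  delayed⇒temporal (step {e} e∈E w departs) =
    step (absorbDelay-∈ e∈E) (delayed⇒temporal w) (≤-trans (≤-reflexive (arrival-absorbDelay e)) departs)

  record Origin (a : Arc n) : Set where
    constructor origin
    field
      travel   : ℕ
      ∈E       : withTravel a travel ∈ E
      no-later : delayedArrival (withTravel a travel) ≤ arrival a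

  origin-of : ∀ {a} → GStarD E D δ a → Origin a
  origin-of {a} (inj₁ (a∈E , a∉D)) = origin (trav a) a∈E (≤-reflexive undelayed)
    where
      undelayed : delayedArrival a ≡ arrival a
      undelayed = trans (cong (λ k → arrival a + k * δ) (iverson-no (∈?-gen _≟Arc_ a D) a∉D))
                        (+-identityʳ (arrival a))
  origin-of (inj₂ (e@(arc _ _ t l) , e∈E , refl)) =
    origin l e∈E (≤-trans (+-monoʳ-≤ (t + l) (iverson-*-≤ (∈?-gen _≟Arc_ e D) δ))
                          (≤-reflexive (+-assoc t l δ)))

  -- The first arc of the result has the departure time of e by construction, which is
  -- exactly what the waiting condition of the enclosing step needs.
  temporal⇒delayed : ∀ {s z e es} → TemporalWalk (GStarD E D δ) s z (e ∷ es) →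
                     ∃₂ λ l hs → DelayedWalk E D δ s z (withTravel e l ∷ hs)
  temporal⇒delayed (single a∈G) with origin-of a∈G
  ... | origin l e∈E _ = l , [] , single e∈E
  temporal⇒delayed (step a∈G w departs) with origin-of a∈G | temporal⇒delayed w
  ... | origin l e∈E no-later | _ , hs , w′ = l , _ ∷ hs , step e∈E w′ (≤-trans no-later departs)

mainTheorem2 : (n : ℕ) (E D : List (Arc n)) → D ⊆ E → (s z : Fin n) (δ : ℕ) →
    (∃ λ ws → DelayedWalk E D δ s z ws) ⇔ (∃ λ ws → TemporalWalk (GStarD E D δ) s z ws)
mainTheorem2 n E D _ s z δ = mk⇔
  (λ { (ws , w) → map (absorbDelay E D δ) ws , delayed⇒temporal E D δ w })
  (λ { ([] , ())
     ; (_ ∷ _ , w) → let (_ , _ , w′) = temporal⇒delayed E D δ w in _ , w′ })
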